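{- The map $\nu : \Gamma \to \Delta_\top$ is a covering if and only if $\Delta_\top$ is a good cover of $(\Delta,\gamma)$.
   Context: Graphs are directed multigraphs $(V,E,\iota,\tau)$; walks may traverse edges in either direction. A covering $\phi:\Gamma\to\Delta$ is an onto graph homomorphism whose restrictions to the in-edges and to the out-edges of each vertex are bijections. Let $(\Delta,\gamma)$ be a voltage graph with voltage assignment $\gamma:E_\Delta\to G$ for a group $G$; the voltage of a walk $p=v_0e_1^{\epsilon_1}v_1\cdots e_n^{\epsilon_n}v_n$ is $\gamma(p)=\prod_k\gamma(e_k)^{\epsilon_k}$ (with $\epsilon_k=\pm1$ according to whether $e_k$ is traversed along or against its orientation). Let $\Gamma=\Delta\times_\gamma G$ be the derived graph, with vertex set $V_\Delta\times G$, edge set $E_\Delta\times G$, $\iota(e,g)=(\iota(e),g)$, $\tau(e,g)=(\tau(e),g\gamma(e))$, and let $\phi:\Gamma\to\Delta$ be the canonical covering $(x,g)\mapsto x$. Fix a base vertex $v_0\in V_\Gamma$ with $\phi(v_0)=v_\Delta$. Let $\Delta_\top$ be a connected graph with a covering $\mu:\Delta_\top\to\Delta$, and let $v_\top$ be a vertex of $\Delta_\top$ with $\mu(v_\top)=v_\Delta$. Define $\nu:\Gamma\to\Delta_\top$ by $\nu(v_0)=v_\top$ and, for each vertex $v$ of $\Gamma$ and each walk $p$ from $v_0$ to $v$, $\nu(v)$ is the terminal vertex of the unique walk $p_\top$ in $\Delta_\top$ starting at $v_\top$ with $\mu(p_\top)=\phi(p)$ (edges mapped correspondingly); by construction $\phi=\mu\nu$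 whenever $\nu$ is well defined. The covering $\mu$ (and $\Delta_\top$) is called good if for each cyclic walk $p$ in $\Delta$ with $\gamma(p)=1_G$, every lift of $p$ with respect to $\mu$ in $\Delta_\top$ is a cyclic walk. -}

module Defs where

open import Data.Product using (Σ; Σ-syntax; _×_; _,_; proj₁; proj₂)
open import Data.List using (List; []; _∷_; map)
open import Relation.Binary.PropositionalEquality using (_≡_)
open import Algebra.Structures using (IsGroup)

record Graph : Set₁ where
  field
    V : Set
    E : Set
    ι : E → V
    τ : E → V

open Graph public

data Dir : Set where
  fw bw : Dir

Step : Graph → Set
Step Γ = E Γ × Dir

stepSrc : (Γ : Graph) → Step Γ → V Γ
stepSrc Γ (e , fw) = ι Γ e
stepSrc Γ (e , bw) = τ Γ e

stepTgt : (Γ : Graph) → Step Γ → V Γ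
stepTgt Γ (e , fw) = τ Γ e
stepTgt Γ (e , bw) = ι Γ e

data IsWalk (Γ : Graph) : V Γ → List (Step Γ) → V Γ → Set where
  nil  : ∀ {u} → IsWalk Γ u [] u
  cons : ∀ {u v} (s : Step Γ) {ss} → stepSrc Γ s ≡ u → IsWalk Γ (stepTgt Γ s) ss v →
         IsWalk Γ u (s ∷ ss) v

Connected : Graph → Set
Connected Γ = (u v : V Γ) → Σ[ ss ∈ List (Step Γ) ] IsWalk Γ u ss v

record IsHom (Γ Δ : Graph) (fV : V Γ → V Δ) (fE : E Γ → E Δ) : Set where
  field
    ι-hom : ∀ e → ι Δ (fE e) ≡ fV (ι Γ e)
    τ-hom : ∀ e → τ Δ (fE e) ≡ fV (τ Γ e)

record IsCovering (Γ Δ : Graph) (fV : V Γ → V Δ) (fE : E Γ → E Δ) : Set where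
  field
    hom      : IsHom Γ Δ fV fE
    ontoV    : ∀ (y : V Δ) → Σ[ x ∈ V Γ ] fV x ≡ y
    ontoE    : ∀ (d : E Δ) → Σ[ e ∈ E Γ ] fE e ≡ d
    out-inj  : ∀ v (e₁ e₂ : E Γ) → ι Γ e₁ ≡ v → ι Γ e₂ ≡ v → fE e₁ ≡ fE e₂ → e₁ ≡ e₂
    out-surj : ∀ v (d : E Δ) → ι Δ d ≡ fV v → Σ[ e ∈ E Γ ] (ι Γ e ≡ v × fE e ≡ d)
    in-inj   : ∀ v (e₁ e₂ : E Γ) → τ Γ e₁ ≡ v → τ Γ e₂ ≡ v → fE e₁ ≡ fE e₂ → e₁ ≡ e₂
    in-surj  : ∀ v (d : E Δ) → τ Δ d ≡ fV v → Σ[ e ∈ E Γ ] (τ Γ e ≡ v × fE e ≡ d)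

mapSteps : {Γ Δ : Graph} → (E Γ → E Δ) → List (Step Γ) → List (Step Δ)
mapSteps f = map (λ s → f (proj₁ s) , proj₂ s)

module Voltage {G : Set} (_∙_ : G → G → G) (ε : G) (_⁻¹ : G → G)
               (Δ : Graph) (γ : E Δ → G) where
  stepVolt : Step Δ → G
  stepVolt (e , fw) = γ e
  stepVolt (e , bw) = (γ e) ⁻¹

  volt : List (Step Δ) → G
  volt [] = ε
  volt (s ∷ ss) = stepVolt s ∙ volt ss

  Derived : Graph
  Derived = record
    { V = V Δ × G
    ; E = E Δ × G
    ; ι = λ { (e , g) → (ι Δ e , g) }
    ; τ = λ { (e , g) → (τ Δ e , g ∙ γ e) }
    }

  φV : V Derived → V Δ
  φV = proj₁

  φE : E Derived → E Δ
  φE = proj₁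

  Good : (Δ⊤ : Graph) (μV : V Δ⊤ → V Δ) (μE : E Δ⊤ → E Δ) → Set
  Good Δ⊤ μV μE =
    ∀ (x : V Δ) (ps : List (Step Δ)) → IsWalk Δ x ps x → volt ps ≡ ε →
    ∀ (y : V Δ⊤) (qs : List (Step Δ⊤)) (z : V Δ⊤) → IsWalk Δ⊤ y qs z →
    μV y ≡ x → mapSteps {Δ⊤} {Δ} μE qs ≡ ps → y ≡ z

  -- ν : Γ → Δ⊤ given by (νV, νE) is the well-defined map of the paper:
  -- ν(v) is the end of the lift from v⊤ of φ(p) for every walk p from v₀ to v,
  -- and edges are sent to the corresponding lifted edges.
  IsNu : (Δ⊤ : Graph) (μE : E Δ⊤ → E Δ) (v₀ : V Derived) (v⊤ : V Δ⊤)
         (νV : V Derived → V Δ⊤) (νE : E Derived → E Δ⊤) → Set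
  IsNu Δ⊤ μE v₀ v⊤ νV νE =
    (∀ (v : V Derived) (ps : List (Step Derived)) → IsWalk Derived v₀ ps v →
     ∀ (qs : List (Step Δ⊤)) (w : V Δ⊤) → IsWalk Δ⊤ v⊤ qs w →
     mapSteps {Δ⊤} {Δ} μE qs ≡ mapSteps {Derived} {Δ} φE ps → νV v ≡ w)
    × IsHom Derived Δ⊤ νV νE
    × (∀ (e : E Derived) → μE (νE e) ≡ φE e)

  NuIsCovering : (Δ⊤ : Graph) (μE : E Δ⊤ → E Δ) (v₀ : V Derived) (v⊤ : V Δ⊤) → Set
  NuIsCovering Δ⊤ μE v₀ v⊤ =
    Σ[ νV ∈ (V Derived → V Δ⊤) ] Σ[ νE ∈ (E Derived → E Δ⊤) ]
      (IsNu Δ⊤ μE v₀ v⊤ νV νE × IsCovering Derived Δ⊤ νV νE)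

{-# OPTIONS --safe #-}
-- The group coordinate of the end of a walk in Δ ×_γ G is its start coordinate times the voltage of
-- the projected walk, so a lift through φ of a closed walk in Δ is closed exactly when that walk has
-- trivial voltage. If ν is a covering, a lift to Δ⊤ from ν(v) of such a walk is, by unique path
-- lifting through μ, the ν-image of its closed φ-lift from v, hence closed. Conversely, if Δ⊤ is
-- good, the μ-lifts from v⊤ of the projections of any two walks from v₀ to v end at the same vertex,
-- because the two projections have equal voltage; so ν is well defined, a homomorphism with μν = φ,
-- onto because Δ⊤ is connected, and locally bijective because μ and φ are.
module Submission where

open import Defs
open import Algebra.Bundles using (Group)
open import Algebra.Structures using (IsGroup)
import Algebra.Properties.Group as GroupProperties
open import Data.List using (List; []; _∷_; _++_; _∷ʳ_; map; reverse)
open import Data.List.Properties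
  using (∷-injectiveˡ; ∷-injectiveʳ; map-++; map-∘; map-cong; map-id; reverse-map; reverse-involutive; unfold-reverse)
open import Data.Product using (Σ-syntax; _×_; _,_; proj₁; proj₂; map₂)
open import Function.Base using (_∘_)
open import Function.Bundles using (_⇔_; mk⇔)
open import Relation.Binary.PropositionalEquality
  using (_≡_; refl; sym; trans; cong; cong₂; subst; module ≡-Reasoning)

flipDir : Dir → Dir
flipDir fw = bw
flipDir bw = fw

flipDir-involutive : ∀ d → flipDir (flipDir d) ≡ d
flipDir-involutive fw = refl
flipDir-involutive bw = refl

flipStep : {X : Set} → X × Dir → X × Dir
flipStep = map₂ flipDir

reverseSteps : {X : Set} → List (X × Dir) → List (X × Dir)
reverseSteps = reverse ∘ map flipStep

reverseSteps-involutive : {X : Set} (ss : List (X × Dir)) → reverseSteps (reverseSteps ss) ≡ ss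
reverseSteps-involutive ss = begin
  reverse (map flipStep (reverse (map flipStep ss))) ≡⟨ cong reverse (reverse-map flipStep (map flipStep ss)) ⟩
  reverse (reverse (map flipStep (map flipStep ss))) ≡⟨ reverse-involutive _ ⟩
  map flipStep (map flipStep ss)                     ≡⟨ map-∘ ss ⟨
  map (flipStep ∘ flipStep) ss                       ≡⟨ map-cong (λ s → cong (proj₁ s ,_) (flipDir-involutive (proj₂ s))) ss ⟩
  map (λ s → s) ss                                   ≡⟨ map-id ss ⟩
  ss                                                 ∎
  where open ≡-Reasoning

module _ {Γ : Graph} where

  walk-end-unique : ∀ {u ss v w} → IsWalk Γ u ss v → IsWalk Γ u ss w → v ≡ w
  walk-end-unique nil          nil           = refl
  walk-end-unique (cons s _ p) (cons .s _ q) = walk-end-unique p q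

  walk-++ : ∀ {u ss v ts w} → IsWalk Γ u ss v → IsWalk Γ v ts w → IsWalk Γ u (ss ++ ts) w
  walk-++ nil          q = q
  walk-++ (cons s e p) q = cons s e (walk-++ p q)

  walk-reverse : ∀ {u ss v} → IsWalk Γ u ss v → IsWalk Γ v (reverseSteps ss) u
  walk-reverse nil = nil
  walk-reverse {ss = s ∷ ss} (cons .s refl p) =
    subst (λ ts → IsWalk Γ _ ts _) (sym (unfold-reverse (flipStep s) (map flipStep ss)))
          (walk-++ (walk-reverse p) (flipped s))
    where
      flipped : (s : Step Γ) → IsWalk Γ (stepTgt Γ s) (flipStep s ∷ []) (stepSrc Γ s)
      flipped (e , fw) = cons (e , bw) refl nil
      flipped (e , bw) = cons (e , fw) refl nil

module _ {Γ Δ : Graph} where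

  mapSteps-reverseSteps : (f : E Γ → E Δ) (ss : List (Step Γ)) →
                          mapSteps {Γ} {Δ} f (reverseSteps ss) ≡ reverseSteps (mapSteps {Γ} {Δ} f ss)
  mapSteps-reverseSteps f ss = begin
    mapSteps {Γ} {Δ} f (reverse (map flipStep ss)) ≡⟨ reverse-map _ (map flipStep ss) ⟩
    reverse (mapSteps {Γ} {Δ} f (map flipStep ss)) ≡⟨ cong reverse (trans (sym (map-∘ {g = stepOver} ss)) (map-∘ ss)) ⟩
    reverse (map flipStep (mapSteps {Γ} {Δ} f ss)) ∎
    where
      open ≡-Reasoning
      stepOver : Step Γ → Step Δ
      stepOver (e , d) = f e , d

  mapSteps-∘ : {Θ : Graph} {f : E Γ → E Θ} {g : E Θ → E Δ} {h : E Γ → E Δ} →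
               (∀ e → g (f e) ≡ h e) → (ss : List (Step Γ)) →
               mapSteps {Θ} {Δ} g (mapSteps {Γ} {Θ} f ss) ≡ mapSteps {Γ} {Δ} h ss
  mapSteps-∘ gf≗h ss = trans (sym (map-∘ ss)) (map-cong (λ s → cong (_, proj₂ s) (gf≗h (proj₁ s))) ss)

module _ {Γ Δ : Graph} {fV : V Γ → V Δ} {fE : E Γ → E Δ} where

  hom-walk : IsHom Γ Δ fV fE → ∀ {u ss v} → IsWalk Γ u ss v → IsWalk Δ (fV u) (mapSteps {Γ} {Δ} fE ss) (fV v)
  hom-walk f nil = nil
  hom-walk f (cons (e , fw) refl p) =
    cons (fE e , fw) (IsHom.ι-hom f e) (subst (λ x → IsWalk Δ x _ _) (sym (IsHom.τ-hom f e)) (hom-walk f p))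
  hom-walk f (cons (e , bw) refl p) =
    cons (fE e , bw) (IsHom.τ-hom f e) (subst (λ x → IsWalk Δ x _ _) (sym (IsHom.ι-hom f e)) (hom-walk f p))

  walk-over-end : IsHom Γ Δ fV fE → ∀ {u qs z x ps y} → IsWalk Γ u qs z → mapSteps {Γ} {Δ} fE qs ≡ ps →
                  fV u ≡ x → IsWalk Δ x ps y → fV z ≡ y
  walk-over-end f q refl refl p = walk-end-unique (hom-walk f q) p

record Lift (Γ Δ : Graph) (fE : E Γ → E Δ) (u : V Γ) (ps : List (Step Δ)) : Set where
  constructor lifted
  field
    {steps} : List (Step Γ)
    {end}   : V Γ
    walk    : IsWalk Γ u steps end
    over    : mapSteps {Γ} {Δ} fE steps ≡ ps

open Lift

module _ {Γ Δ : Graph} {fV : V Γ → V Δ} {fE : E Γ → E Δ} (f : IsCovering Γ Δ fV fE) where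
  open IsCovering f

  lift : ∀ {u x ps y} → fV u ≡ x → IsWalk Δ x ps y → Lift Γ Δ fE u ps
  lift refl nil = lifted nil refl
  lift {u} refl (cons (d , fw) ιd p) with out-surj u d ιd
  ... | e , ιe , refl with lift (sym (IsHom.τ-hom hom e)) p
  ...   | lifted q q-over = lifted (cons (e , fw) ιe q) (cong (_ ∷_) q-over)
  lift {u} refl (cons (d , bw) τd p) with in-surj u d τd
  ... | e , τe , refl with lift (sym (IsHom.ι-hom hom e)) p
  ...   | lifted q q-over = lifted (cons (e , bw) τe q) (cong (_ ∷_) q-over)

  lift-end : ∀ {u x ps y} (u-over : fV u ≡ x) (p : IsWalk Δ x ps y) → fV (end (lift u-over p)) ≡ y
  lift-end u-over p = walk-over-end hom (walk (lift u-over p)) (over (lift u-over p)) u-over p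

  lift-end-unique : ∀ {u qs qs′ z z′} → IsWalk Γ u qs z → IsWalk Γ u qs′ z′ →
                    mapSteps {Γ} {Δ} fE qs ≡ mapSteps {Γ} {Δ} fE qs′ → z ≡ z′
  lift-end-unique nil nil _ = refl
  lift-end-unique nil (cons _ _ _) ()
  lift-end-unique (cons _ _ _) nil ()
  lift-end-unique (cons (e , fw) ιe q) (cons (e′ , fw) ιe′ q′) eq
    with out-inj _ e e′ ιe ιe′ (cong proj₁ (∷-injectiveˡ eq))
  ... | refl = lift-end-unique q q′ (∷-injectiveʳ eq)
  lift-end-unique (cons (e , bw) τe q) (cons (e′ , bw) τe′ q′) eq
    with in-inj _ e e′ τe τe′ (cong proj₁ (∷-injectiveˡ eq))
  ... | refl = lift-end-unique q q′ (∷-injectiveʳ eq)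
  lift-end-unique (cons (_ , fw) _ _) (cons (_ , bw) _ _) eq with cong proj₂ (∷-injectiveˡ eq)
  ... | ()
  lift-end-unique (cons (_ , bw) _ _) (cons (_ , fw) _ _) eq with cong proj₂ (∷-injectiveˡ eq)
  ... | ()

factor-isCovering : ∀ {Γ Θ Δ : Graph} {φV : V Γ → V Δ} {φE : E Γ → E Δ} {μV : V Θ → V Δ} {μE : E Θ → E Δ}
                    {νV : V Γ → V Θ} {νE : E Γ → E Θ} →
                    IsCovering Γ Δ φV φE → IsCovering Θ Δ μV μE → IsHom Γ Θ νV νE →
                    (∀ v → μV (νV v) ≡ φV v) → (∀ e → μE (νE e) ≡ φE e) →
                    (∀ y → Σ[ x ∈ V Γ ] νV x ≡ y) → IsCovering Γ Θ νV νE
factor-isCovering {Γ} {Θ} {φE = φE} {μV} {μE} {νV} {νE} φ μ ν overV overE ontoV = record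
  { hom      = ν
  ; ontoV    = ontoV
  ; ontoE    = ontoE
  ; out-inj  = λ v e₁ e₂ p₁ p₂ eq → φ.out-inj v e₁ e₂ p₁ p₂ (over-≡ eq)
  ; out-surj = out-surj
  ; in-inj   = λ v e₁ e₂ p₁ p₂ eq → φ.in-inj v e₁ e₂ p₁ p₂ (over-≡ eq)
  ; in-surj  = in-surj
  }
  where
    module φ = IsCovering φ
    module μ = IsCovering μ
    module ν = IsHom ν

    over-≡ : ∀ {e₁ e₂} → νE e₁ ≡ νE e₂ → φE e₁ ≡ φE e₂
    over-≡ {e₁} {e₂} eq = trans (sym (overE e₁)) (trans (cong μE eq) (overE e₂))

    out-surj : ∀ v (d : E Θ) → ι Θ d ≡ νV v → Σ[ e ∈ E Γ ] (ι Γ e ≡ v × νE e ≡ d)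
    out-surj v d ιd with φ.out-surj v (μE d) (trans (IsHom.ι-hom μ.hom d) (trans (cong μV ιd) (overV v)))
    ... | e , refl , φe = e , refl , μ.out-inj _ (νE e) d (ν.ι-hom e) ιd (trans (overE e) φe)

    in-surj : ∀ v (d : E Θ) → τ Θ d ≡ νV v → Σ[ e ∈ E Γ ] (τ Γ e ≡ v × νE e ≡ d)
    in-surj v d τd with φ.in-surj v (μE d) (trans (IsHom.τ-hom μ.hom d) (trans (cong μV τd) (overV v)))
    ... | e , refl , φe = e , refl , μ.in-inj _ (νE e) d (ν.τ-hom e) τd (trans (overE e) φe)

    ontoE : ∀ d → Σ[ e ∈ E Γ ] νE e ≡ d
    ontoE d with ontoV (ι Θ d)
    ... | x , νx = let e , _ , νe = out-surj x d (sym νx) in e , νe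

module DerivedGraph {G : Set} {_∙_ : G → G → G} {ε : G} {_⁻¹ : G → G} (isGroup : IsGroup _≡_ _∙_ ε _⁻¹)
                    (Δ : Graph) (γ : E Δ → G) where
  open Voltage _∙_ ε _⁻¹ Δ γ
  open IsGroup isGroup using (assoc; identityˡ; identityʳ)

  group : Group _ _
  group = record { isGroup = isGroup }

  open GroupProperties group
    using (∙-cancelˡ; ∙-cancelʳ; //-rightDividesˡ; //-rightDividesʳ; ε⁻¹≈ε; ⁻¹-involutive; ⁻¹-anti-homo-∙; x≈y⇒x∙y⁻¹≈ε)

  volt-++ : ∀ ps qs → volt (ps ++ qs) ≡ volt ps ∙ volt qs
  volt-++ []       qs = sym (identityˡ (volt qs))
  volt-++ (p ∷ ps) qs = trans (cong (stepVolt p ∙_) (volt-++ ps qs)) (sym (assoc _ _ _))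

  stepVolt-flipStep : ∀ s → stepVolt (flipStep s) ≡ stepVolt s ⁻¹
  stepVolt-flipStep (e , fw) = refl
  stepVolt-flipStep (e , bw) = sym (⁻¹-involutive (γ e))

  volt-reverseSteps : ∀ ps → volt (reverseSteps ps) ≡ volt ps ⁻¹
  volt-reverseSteps []       = sym ε⁻¹≈ε
  volt-reverseSteps (p ∷ ps) = begin
    volt (reverseSteps (p ∷ ps))                   ≡⟨ cong volt (unfold-reverse (flipStep p) (map flipStep ps)) ⟩
    volt (reverseSteps ps ∷ʳ flipStep p)           ≡⟨ volt-++ (reverseSteps ps) _ ⟩
    volt (reverseSteps ps) ∙ (stepVolt (flipStep p) ∙ ε)
      ≡⟨ cong₂ _∙_ (volt-reverseSteps ps) (trans (identityʳ _) (stepVolt-flipStep p)) ⟩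
    (volt ps ⁻¹) ∙ (stepVolt p ⁻¹)                  ≡⟨ ⁻¹-anti-homo-∙ (stepVolt p) (volt ps) ⟨
    (stepVolt p ∙ volt ps) ⁻¹                       ∎
    where open ≡-Reasoning

  φ-isCovering : IsCovering Derived Δ φV φE
  φ-isCovering = record
    { hom      = record { ι-hom = λ _ → refl ; τ-hom = λ _ → refl }
    ; ontoV    = λ x → (x , ε) , refl
    ; ontoE    = λ d → (d , ε) , refl
    ; out-inj  = λ { _ (d , _) _ p₁ p₂ refl → cong (d ,_) (cong proj₂ (trans p₁ (sym p₂))) }
    ; out-surj = λ { (_ , g) d ιd → (d , g) , cong (_, g) ιd , refl }
    ; in-inj   = λ { _ (d , g₁) (_ , g₂) p₁ p₂ refl →
                     cong (d ,_) (∙-cancelʳ (γ d) g₁ g₂ (cong proj₂ (trans p₁ (sym p₂)))) }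
    ; in-surj  = λ { (_ , g) d τd → (d , g ∙ (γ d ⁻¹)) , cong₂ _,_ τd (//-rightDividesˡ (γ d) g) , refl }
    }

  walk-coordinate : ∀ {u ps v} → IsWalk Derived u ps v →
                    proj₂ v ≡ proj₂ u ∙ volt (mapSteps {Derived} {Δ} φE ps)
  walk-coordinate nil = sym (identityʳ _)
  walk-coordinate (cons ((d , g) , fw) refl p) = trans (walk-coordinate p) (assoc g (γ d) _)
  walk-coordinate (cons ((d , g) , bw) refl p) =
    trans (walk-coordinate p) (trans (cong (_∙ _) (sym (//-rightDividesʳ (γ d) g))) (assoc _ (γ d ⁻¹) _))

  closed-of-trivial-voltage : ∀ {u ps v} → IsWalk Derived u ps v → φV v ≡ φV u →
                              volt (mapSteps {Derived} {Δ} φE ps) ≡ ε → v ≡ u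
  closed-of-trivial-voltage p closed trivial =
    cong₂ _,_ closed (trans (walk-coordinate p) (trans (cong (_ ∙_) trivial) (identityʳ _)))

  coterminal-walks-equal-voltage : ∀ {u ps ps′ v} → IsWalk Derived u ps v → IsWalk Derived u ps′ v →
                                   volt (mapSteps {Derived} {Δ} φE ps) ≡ volt (mapSteps {Derived} {Δ} φE ps′)
  coterminal-walks-equal-voltage {u} p p′ =
    ∙-cancelˡ (proj₂ u) _ _ (trans (sym (walk-coordinate p)) (walk-coordinate p′))

  -- Going along ps and back along ps′ is a closed walk of trivial voltage, so its lift from y
  -- returns to y; reversing the second half then gives a lift of ps′ from y that ends at z.
  good⇒equal-voltage-lifts-coterminate :
    ∀ {Δ⊤ : Graph} {μV : V Δ⊤ → V Δ} {μE : E Δ⊤ → E Δ} → IsCovering Δ⊤ Δ μV μE → Good Δ⊤ μV μE →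
    ∀ {x ps ps′ x′ y qs qs′ z z′} →
    IsWalk Δ x ps x′ → IsWalk Δ x ps′ x′ → volt ps ≡ volt ps′ → μV y ≡ x →
    IsWalk Δ⊤ y qs z → mapSteps {Δ⊤} {Δ} μE qs ≡ ps →
    IsWalk Δ⊤ y qs′ z′ → mapSteps {Δ⊤} {Δ} μE qs′ ≡ ps′ → z ≡ z′
  good⇒equal-voltage-lifts-coterminate {Δ⊤} {μE = μE} μ good {x} {ps} {ps′} {y = y} {qs} {z = z}
                                       p p′ same y-over q q-over q′ q′-over =
    lift-end-unique μ back q′ (trans back-over (sym q′-over))
    where
      r : Lift Δ⊤ Δ μE z (reverseSteps ps′)
      r = lift μ (walk-over-end (IsCovering.hom μ) q q-over y-over p) (walk-reverse p′)

      loop-trivial : volt (ps ++ reverseSteps ps′) ≡ ε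
      loop-trivial = trans (volt-++ ps _) (trans (cong (volt ps ∙_) (volt-reverseSteps ps′)) (x≈y⇒x∙y⁻¹≈ε same))

      returns : y ≡ end r
      returns = good x _ (walk-++ p (walk-reverse p′)) loop-trivial y (qs ++ steps r) (end r)
                     (walk-++ q (walk r)) y-over (trans (map-++ _ qs (steps r)) (cong₂ _++_ q-over (over r)))

      back : IsWalk Δ⊤ y (reverseSteps (steps r)) z
      back = subst (λ w → IsWalk Δ⊤ w (reverseSteps (steps r)) z) (sym returns) (walk-reverse (walk r))

      back-over : mapSteps {Δ⊤} {Δ} μE (reverseSteps (steps r)) ≡ ps′
      back-over = begin
        mapSteps {Δ⊤} {Δ} μE (reverseSteps (steps r)) ≡⟨ mapSteps-reverseSteps {Δ⊤} {Δ} μE (steps r) ⟩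
        reverseSteps (mapSteps {Δ⊤} {Δ} μE (steps r)) ≡⟨ cong reverseSteps (over r) ⟩
        reverseSteps (reverseSteps ps′)               ≡⟨ reverseSteps-involutive ps′ ⟩
        ps′                                           ∎
        where open ≡-Reasoning

  module _ (connected : Connected Derived) (v₀ : V Derived) {Δ⊤ : Graph} (connected⊤ : Connected Δ⊤)
           {μV : V Δ⊤ → V Δ} {μE : E Δ⊤ → E Δ} (μ : IsCovering Δ⊤ Δ μV μE)
           {v⊤ : V Δ⊤} (v⊤-over : μV v⊤ ≡ φV v₀) where

    path : ∀ v → IsWalk Derived v₀ (proj₁ (connected v₀ v)) v
    path v = proj₂ (connected v₀ v)

    liftPath : ∀ v → Lift Δ⊤ Δ μE v⊤ (mapSteps {Derived} {Δ} φE (proj₁ (connected v₀ v)))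
    liftPath v = lift μ v⊤-over (hom-walk (IsCovering.hom φ-isCovering) (path v))

    liftPath-over : ∀ v → μV (end (liftPath v)) ≡ φV v
    liftPath-over v = lift-end μ v⊤-over (hom-walk (IsCovering.hom φ-isCovering) (path v))

    IsLiftEndpoint : (V Derived → V Δ⊤) → Set
    IsLiftEndpoint νV = ∀ v ps → IsWalk Derived v₀ ps v → ∀ qs w → IsWalk Δ⊤ v⊤ qs w →
                        mapSteps {Δ⊤} {Δ} μE qs ≡ mapSteps {Derived} {Δ} φE ps → νV v ≡ w

    liftEndpoint-over : ∀ {νV} → IsLiftEndpoint νV → ∀ v → μV (νV v) ≡ φV v
    liftEndpoint-over endpoint v =
      trans (cong μV (endpoint v _ (path v) _ _ (walk (liftPath v)) (over (liftPath v)))) (liftPath-over v)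

    nuIsCovering⇒good : NuIsCovering Δ⊤ μE v₀ v⊤ → Good Δ⊤ μV μE
    nuIsCovering⇒good (νV , νE , (endpoint , ν-hom , νE-over) , ν-covering) x ps p trivial y qs z q y-over q-over =
      begin
        y           ≡⟨ νv≡y ⟨
        νV v        ≡⟨ cong νV closed ⟨
        νV (end l)  ≡⟨ lift-end-unique μ image q (trans (mapSteps-∘ {Derived} {Δ} {Δ⊤} νE-over (steps l)) (trans (over l) (sym q-over))) ⟩
        z           ∎
      where
        open ≡-Reasoning
        v : V Derived
        v = proj₁ (IsCovering.ontoV ν-covering y)

        νv≡y : νV v ≡ y
        νv≡y = proj₂ (IsCovering.ontoV ν-covering y)

        v-over : φV v ≡ x
        v-over = trans (sym (liftEndpoint-over endpoint v)) (trans (cong μV νv≡y) y-over)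

        l : Lift Derived Δ φE v ps
        l = lift φ-isCovering v-over p

        closed : end l ≡ v
        closed = closed-of-trivial-voltage (walk l) (trans (lift-end φ-isCovering v-over p) (sym v-over))
                                           (trans (cong volt (over l)) trivial)

        image : IsWalk Δ⊤ y (mapSteps {Derived} {Δ⊤} νE (steps l)) (νV (end l))
        image = subst (λ w → IsWalk Δ⊤ w (mapSteps {Derived} {Δ⊤} νE (steps l)) (νV (end l))) νv≡y
                      (hom-walk ν-hom (walk l))

    module _ (good : Good Δ⊤ μV μE) where

      νV : V Derived → V Δ⊤
      νV v = end (liftPath v)

      νV-isLiftEndpoint : IsLiftEndpoint νV
      νV-isLiftEndpoint v ps p qs w q q-over =
        good⇒equal-voltage-lifts-coterminate μ good (hom-walk (IsCovering.hom φ-isCovering) (path v))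
          (hom-walk (IsCovering.hom φ-isCovering) p) (coterminal-walks-equal-voltage (path v) p)
          v⊤-over (walk (liftPath v)) (over (liftPath v)) q q-over

      edgeLift : ∀ e → Σ[ d ∈ E Δ⊤ ] (ι Δ⊤ d ≡ νV (ι Derived e) × μE d ≡ φE e)
      edgeLift e = IsCovering.out-surj μ (νV (ι Derived e)) (φE e) (sym (liftPath-over (ι Derived e)))

      νE : E Derived → E Δ⊤
      νE e = proj₁ (edgeLift e)

      νE-over : ∀ e → μE (νE e) ≡ φE e
      νE-over e = proj₂ (proj₂ (edgeLift e))

      νE-τ : ∀ e → τ Δ⊤ (νE e) ≡ νV (τ Derived e)
      νE-τ e = sym (νV-isLiftEndpoint (τ Derived e) _ (walk-++ (path u) (cons (e , fw) refl nil)) _ _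
                      (walk-++ (walk (liftPath u)) (cons (νE e , fw) (proj₁ (proj₂ (edgeLift e))) nil)) extended-over)
        where
          open ≡-Reasoning
          u : V Derived
          u = ι Derived e

          c : List (Step Derived)
          c = proj₁ (connected v₀ u)

          extended-over : mapSteps {Δ⊤} {Δ} μE (steps (liftPath u) ++ (νE e , fw) ∷ [])
                          ≡ mapSteps {Derived} {Δ} φE (c ++ (e , fw) ∷ [])
          extended-over = begin
            mapSteps {Δ⊤} {Δ} μE (steps (liftPath u) ++ (νE e , fw) ∷ [])
              ≡⟨ map-++ _ (steps (liftPath u)) _ ⟩
            mapSteps {Δ⊤} {Δ} μE (steps (liftPath u)) ++ (μE (νE e) , fw) ∷ []
              ≡⟨ cong₂ _++_ (over (liftPath u)) (cong (λ d → (d , fw) ∷ []) (νE-over e)) ⟩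
            mapSteps {Derived} {Δ} φE c ++ (φE e , fw) ∷ []
              ≡⟨ map-++ _ c _ ⟨
            mapSteps {Derived} {Δ} φE (c ++ (e , fw) ∷ [])
              ∎

      ν-isHom : IsHom Derived Δ⊤ νV νE
      ν-isHom = record { ι-hom = λ e → proj₁ (proj₂ (edgeLift e)) ; τ-hom = νE-τ }

      νV-onto : ∀ y → Σ[ v ∈ V Derived ] νV v ≡ y
      νV-onto y = end l , νV-isLiftEndpoint (end l) (steps l) (walk l) _ y q (sym (over l))
        where
          q : IsWalk Δ⊤ v⊤ (proj₁ (connected⊤ v⊤ y)) y
          q = proj₂ (connected⊤ v⊤ y)

          l : Lift Derived Δ φE v₀ (mapSteps {Δ⊤} {Δ} μE (proj₁ (connected⊤ v⊤ y)))
          l = lift φ-isCovering (sym v⊤-over) (hom-walk (IsCovering.hom μ) q)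

      good⇒nuIsCovering : NuIsCovering Δ⊤ μE v₀ v⊤
      good⇒nuIsCovering =
        νV , νE , (νV-isLiftEndpoint , ν-isHom , νE-over) ,
        factor-isCovering φ-isCovering μ ν-isHom liftPath-over νE-over νV-onto

proposition4p10 : (G : Set) (_∙_ : G → G → G) (ε : G) (_⁻¹ : G → G) → IsGroup _≡_ _∙_ ε _⁻¹ →
    (Δ : Graph) (γ : E Δ → G) →
    let open Voltage _∙_ ε _⁻¹ Δ γ in
    Connected Derived →
    (v₀ : V Derived) →
    (Δ⊤ : Graph) → Connected Δ⊤ →
    (μV : V Δ⊤ → V Δ) (μE : E Δ⊤ → E Δ) → IsCovering Δ⊤ Δ μV μE →
    (v⊤ : V Δ⊤) → μV v⊤ ≡ φV v₀ →
    (NuIsCovering Δ⊤ μE v₀ v⊤ ⇔ Good Δ⊤ μV μE)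
proposition4p10 _ _ _ _ isGroup Δ γ connected v₀ _ connected⊤ _ _ μ _ v⊤-over =
  mk⇔ (nuIsCovering⇒good connected v₀ connected⊤ μ v⊤-over) (good⇒nuIsCovering connected v₀ connected⊤ μ v⊤-over)
  where open DerivedGraph isGroup Δ γ
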